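{- For any graph $H$ of diameter $D(H)\ge 6$ and any $k\in\{1,\ldots,\mathcal{C}(K_1+H)\}$, $\operatorname{adim}_k(K_1+H)=\operatorname{adim}_k(H)$.
   Context: All graphs are finite and simple; $D(H)$ is the (finite) diameter of $H$. The join $K_1+H$ is obtained from $H$ by adding a new vertex adjacent to all vertices of $H$. For a graph $G=(V,E)$, $d_{G,2}(x,y)=\min\{d_G(x,y),2\}$ with $d_G$ the shortest-path distance. For distinct $x,y$, $\mathcal{C}_G(x,y)=\{z\in V: d_{G,2}(x,z)\ne d_{G,2}(y,z)\}$, $\mathcal{C}(G)=\min_{x\ne y}|\mathcal{C}_G(x,y)|$. A set $S\subseteq V$ is a $k$-adjacency generator if $|S\cap\mathcal{C}_G(x,y)|\ge k$ for all distinct $x,y$; $\operatorname{adim}_k(G)$ is the minimum cardinality of such a set. -}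

module Defs where

open import Data.Nat using (ℕ; zero; suc; _≤_; _<_; _≟_)
open import Data.Bool using (Bool; true; false; if_then_else_)
open import Data.Fin using (Fin; zero; suc)
import Data.Fin as F
open import Data.Fin.Subset using (Subset; _∈_; _∩_; ∣_∣)
open import Data.Vec using (tabulate)
open import Data.Product using (Σ; ∃; _×_; _,_)
open import Relation.Nullary using (¬_; does)
open import Relation.Binary.PropositionalEquality using (_≡_; _≢_)

record Graph (n : ℕ) : Set where
  field
    adj   : Fin n → Fin n → Bool
    sym   : ∀ x y → adj x y ≡ adj y x
    irrefl : ∀ x → adj x x ≡ false
open Graph public

data Walk {n : ℕ} (G : Graph n) : Fin n → Fin n → ℕ → Set where
  here : ∀ {x} → Walk G x x 0
  step : ∀ {x y z l} → adj G x y ≡ true → Walk G y z l → Walk G x z (suc l)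

Dist : {n : ℕ} → Graph n → Fin n → Fin n → ℕ → Set
Dist G x y d = Walk G x y d × (∀ l → l < d → ¬ Walk G x y l)

Connected : {n : ℕ} → Graph n → Set
Connected G = ∀ x y → ∃ λ l → Walk G x y l

DiameterAtLeast : {n : ℕ} → Graph n → ℕ → Set
DiameterAtLeast G m = Connected G × Σ _ λ x → Σ _ λ y → Σ ℕ λ d → Dist G x y d × m ≤ d

-- The join K₁ + H; the new vertex is zero.
join : {n : ℕ} → Graph n → Graph (suc n)
join {n} H = record { adj = a ; sym = s ; irrefl = i }
  where
  a : Fin (suc n) → Fin (suc n) → Bool
  a zero zero = false
  a zero (suc _) = true
  a (suc _) zero = true
  a (suc x) (suc y) = adj H x y
  s : ∀ x y → a x y ≡ a y x
  s zero zero = Relation.Binary.PropositionalEquality.refl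
  s zero (suc _) = Relation.Binary.PropositionalEquality.refl
  s (suc _) zero = Relation.Binary.PropositionalEquality.refl
  s (suc x) (suc y) = sym H x y
  i : ∀ x → a x x ≡ false
  i zero = Relation.Binary.PropositionalEquality.refl
  i (suc x) = irrefl H x

-- d_{G,2}(x,y) = min(d_G(x,y), 2) for a simple graph: 0 if x = y, 1 if adjacent, 2 otherwise.
d₂ : {n : ℕ} → Graph n → Fin n → Fin n → ℕ
d₂ G x y = if does (x F.≟ y) then 0 else (if adj G x y then 1 else 2)

𝒞 : {n : ℕ} → Graph n → Fin n → Fin n → Subset n
𝒞 G x y = tabulate λ z → if does (d₂ G x z ≟ d₂ G y z) then false else true

-- k ≤ 𝒞(G) = min_{x ≠ y} |𝒞_G(x,y)|
_≤𝒞_ : ℕ → {n : ℕ} → Graph n → Set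
k ≤𝒞 G = ∀ x y → x ≢ y → k ≤ ∣ 𝒞 G x y ∣

IsKAdjGen : {n : ℕ} → Graph n → ℕ → Subset n → Set
IsKAdjGen G k S = ∀ x y → x ≢ y → k ≤ ∣ S ∩ 𝒞 G x y ∣

IsAdim : {n : ℕ} → Graph n → ℕ → ℕ → Set
IsAdim G k m = (Σ (Subset _) λ S → IsKAdjGen G k S × ∣ S ∣ ≡ m)
             × (∀ S → IsKAdjGen G k S → m ≤ ∣ S ∣)

-- The apex of K₁ + H is at d₂-distance 1 from every vertex of H, so the pairs of K₁ + H not
-- already pairs of H are (apex, y), and 𝒞(apex, y) is the apex together with all z with
-- d₂(y, z) ≠ 1.  When D(H) ≥ 6 every y has two distinct vertices a, a' at distance ≥ 3; no
-- neighbour of y then tells a and a' apart, so 𝒞_H(a, a') ⊆ 𝒞(apex, y).  Hence every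
-- k-adjacency generator of H is one of K₁ + H, and conversely every k-adjacency generator of
-- K₁ + H restricts to one of H, which gives equal minimum cardinalities.
module Submission where

open import Defs
open import Data.Nat using (ℕ; _≤_)
open import Data.Product using (Σ; _×_)

open import Data.Nat using (zero; suc; _+_; _<_; _≟_; _≤?_; _<?_; z≤n; s≤s)
open import Data.Nat.Properties using (≤-trans; +-mono-≤; ≮⇒≥; <⇒≱; n≤1+n)
open import Data.Nat.Induction using (<-wellFounded)
open import Induction.WellFounded using (Acc; acc)
open import Data.Bool using (true; false; if_then_else_) renaming (_≟_ to _≟ᵇ_)
open import Data.Fin using (Fin; zero; suc)
import Data.Fin as F
import Data.Fin.Properties as F
open import Data.Fin.Subset using (Subset; _∈_; _∩_; ∣_∣; _⊆_; ⊤; inside; outside)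
open import Data.Fin.Subset.Properties
  using (p⊆q⇒∣p∣≤∣q∣; x∈p∩q⁺; x∈p∩q⁻; anySubset?; ∣p∣≤∣x∷p∣; ∩-identityˡ; drop-there)
open import Data.Vec using (_∷_; tail)
open import Data.Vec.Properties using (lookup∘tabulate; []=⇒lookup; lookup⇒[]=)
open import Data.Product using (∃-syntax; _,_)
open import Data.Sum using (_⊎_; inj₁; inj₂)
open import Data.Empty using (⊥-elim)
open import Relation.Nullary using (¬_; Dec; yes; no; does)
open import Relation.Nullary.Decidable using (_×-dec_; _⊎-dec_; _→-dec_; ¬?)
open import Relation.Unary using (Decidable)
open import Function using (_∘_)
open import Relation.Binary.PropositionalEquality
  using (_≡_; _≢_; refl; trans; cong; subst) renaming (sym to ≡-sym)

Within : ∀ {n} → Graph n → ℕ → Fin n → Fin n → Set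
Within G zero    x y = x ≡ y
Within G (suc r) x y = x ≡ y ⊎ ∃[ z ] adj G x z ≡ true × Within G r z y

within? : ∀ {n} (G : Graph n) r x y → Dec (Within G r x y)
within? G zero    x y = x F.≟ y
within? G (suc r) x y = x F.≟ y ⊎-dec F.any? λ z → (adj G x z ≟ᵇ true) ×-dec within? G r z y

FarPair : ∀ {n} → Graph n → Fin n → Set
FarPair {n} G y = Σ (Fin n) λ a → Σ (Fin n) λ b → a ≢ b × ¬ Within G 2 y a × ¬ Within G 2 y b

module _ {n} {G : Graph n} where

  _++ʷ_ : ∀ {x y z l m} → Walk G x y l → Walk G y z m → Walk G x z (l + m)
  here     ++ʷ q = q
  step e p ++ʷ q = step e (p ++ʷ q)

  _∷ʳʷ_ : ∀ {x y z l} → Walk G x y l → adj G y z ≡ true → Walk G x z (suc l)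
  here     ∷ʳʷ e = step e here
  step e p ∷ʳʷ e′ = step e (p ∷ʳʷ e′)

  reverseʷ : ∀ {x y l} → Walk G x y l → Walk G y x l
  reverseʷ here = here
  reverseʷ (step {x} {y} e p) = reverseʷ p ∷ʳʷ trans (sym G y x) e

  adj⇒≢ : ∀ {x y} → adj G x y ≡ true → x ≢ y
  adj⇒≢ {x} e refl with trans (≡-sym (irrefl G x)) e
  ... | ()

  dist≤walk : ∀ {x y d l} → Dist G x y d → Walk G x y l → d ≤ l
  dist≤walk (_ , noShorter) w = ≮⇒≥ λ l<d → noShorter _ l<d w

  dist-sym : ∀ {x y d} → Dist G x y d → Dist G y x d
  dist-sym (w , noShorter) = reverseʷ w , λ l l<d w′ → noShorter l l<d (reverseʷ w′)

  dist>0⇒≢ : ∀ {x y d} → Dist G x y d → 0 < d → x ≢ y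
  dist>0⇒≢ dist 0<d refl = <⇒≱ 0<d (dist≤walk dist here)

  within⇒walk : ∀ {r x y} → Within G r x y → ∃[ l ] l ≤ r × Walk G x y l
  within⇒walk {zero}  refl = 0 , z≤n , here
  within⇒walk {suc r} (inj₁ refl) = 0 , z≤n , here
  within⇒walk {suc r} (inj₂ (z , e , z~y)) with within⇒walk z~y
  ... | l , l≤r , w = suc l , s≤s l≤r , step e w

  -- The pair is (a, a₁) for the successor a₁ of a on the geodesic, or else (a, b).
  farPair-fromEnd : ∀ {a b d y} → Dist G a b d → 6 ≤ d → ¬ Within G 2 y a → FarPair G y
  farPair-fromEnd (here , _) () _
  farPair-fromEnd {a} {b} {y = y} dist@(step {y = a₁} a~a₁ _ , _) 6≤d y≁a
    with within? G 2 y a₁ | within? G 2 y b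
  ... | no y≁a₁ | _ = a , a₁ , adj⇒≢ a~a₁ , y≁a , y≁a₁
  ... | yes _ | no y≁b = a , b , dist>0⇒≢ dist (≤-trans (s≤s z≤n) 6≤d) , y≁a , y≁b
  ... | yes y~a₁ | yes y~b with within⇒walk y~a₁ | within⇒walk y~b
  ... | i , i≤2 , y→a₁ | j , j≤2 , y→b =
    ⊥-elim (<⇒≱ 6≤d (≤-trans (dist≤walk dist (step a~a₁ (reverseʷ y→a₁ ++ʷ y→b)))
                              (s≤s (+-mono-≤ i≤2 j≤2))))

  farPair : DiameterAtLeast G 6 → ∀ y → FarPair G y
  farPair (_ , a , b , d , dist , 6≤d) y with within? G 2 y a | within? G 2 y b
  ... | no y≁a | _ = farPair-fromEnd dist 6≤d y≁a
  ... | yes _ | no y≁b = farPair-fromEnd (dist-sym dist) 6≤d y≁b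
  ... | yes y~a | yes y~b with within⇒walk y~a | within⇒walk y~b
  ... | i , i≤2 , y→a | j , j≤2 , y→b =
    ⊥-elim (<⇒≱ 6≤d (≤-trans (dist≤walk dist (reverseʷ y→a ++ʷ y→b))
                              (+-mono-≤ i≤2 (≤-trans j≤2 (n≤1+n 2)))))

∩-monoʳ-⊆ : ∀ {n} (p : Subset n) {q r} → q ⊆ r → p ∩ q ⊆ p ∩ r
∩-monoʳ-⊆ p {q} q⊆r x∈ with x∈p∩q⁻ p q x∈
... | x∈p , x∈q = x∈p∩q⁺ (x∈p , q⊆r x∈q)

∣∩∣-monoʳ : ∀ {n} (p : Subset n) {q r} → q ⊆ r → ∣ p ∩ q ∣ ≤ ∣ p ∩ r ∣
∣∩∣-monoʳ p q⊆r = p⊆q⇒∣p∣≤∣q∣ (∩-monoʳ-⊆ p q⊆r)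

¬-if-does : ∀ {A : Set} (a? : Dec A) → (if does a? then false else true) ≡ true → ¬ A
¬-if-does (yes _) ()
¬-if-does (no ¬a) _ = ¬a

if-does-¬ : ∀ {A : Set} (a? : Dec A) → ¬ A → (if does a? then false else true) ≡ true
if-does-¬ (yes a) ¬a = ⊥-elim (¬a a)
if-does-¬ (no _) _ = refl

module _ {n} (G : Graph n) where

  ∈𝒞⁻ : ∀ x y {z} → z ∈ 𝒞 G x y → d₂ G x z ≢ d₂ G y z
  ∈𝒞⁻ x y {z} z∈ =
    ¬-if-does (d₂ G x z ≟ d₂ G y z) (trans (≡-sym (lookup∘tabulate _ z)) ([]=⇒lookup z∈))

  ∈𝒞⁺ : ∀ x y {z} → d₂ G x z ≢ d₂ G y z → z ∈ 𝒞 G x y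
  ∈𝒞⁺ x y {z} ne =
    lookup⇒[]= z (𝒞 G x y) (trans (lookup∘tabulate _ z) (if-does-¬ (d₂ G x z ≟ d₂ G y z) ne))

  𝒞-comm : ∀ x y → 𝒞 G x y ⊆ 𝒞 G y x
  𝒞-comm x y z∈ = ∈𝒞⁺ y x λ e → ∈𝒞⁻ x y z∈ (≡-sym e)

module _ {n} {G : Graph n} where

  d₂≡1⇒adj : ∀ {x z} → d₂ G x z ≡ 1 → adj G x z ≡ true
  d₂≡1⇒adj {x} {z} _ with x F.≟ z | adj G x z
  ... | no _ | true = refl
  d₂≡1⇒adj () | yes _ | _
  d₂≡1⇒adj () | no _ | false

  d₂-far : ∀ {y z w} → adj G y z ≡ true → ¬ Within G 2 y w → d₂ G w z ≡ 2
  d₂-far {y} {z} {w} y~z y≁w with w F.≟ z | adj G w z in w~z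
  ... | yes refl | _ = ⊥-elim (y≁w (inj₂ (z , y~z , inj₁ refl)))
  ... | no _ | true = ⊥-elim (y≁w (inj₂ (z , y~z , inj₂ (w , trans (sym G z w) w~z , refl))))
  ... | no _ | false = refl

  farPair-separator : ∀ {y a b z} → ¬ Within G 2 y a → ¬ Within G 2 y b →
                      z ∈ 𝒞 G a b → d₂ G y z ≢ 1
  farPair-separator {a = a} {b} y≁a y≁b z∈ d≡1 =
    ∈𝒞⁻ G a b z∈ (trans (d₂-far (d₂≡1⇒adj d≡1) y≁a) (≡-sym (d₂-far (d₂≡1⇒adj d≡1) y≁b)))

module _ {n} {H : Graph n} where

  ∈𝒞-join-apex : ∀ y {z} → d₂ H y z ≢ 1 → suc z ∈ 𝒞 (join H) zero (suc y)
  ∈𝒞-join-apex y ne = ∈𝒞⁺ (join H) zero (suc y) λ e → ne (≡-sym e)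

  -- Splitting on b lets (b ∧ false) ∷ _ reduce, so the join's count becomes H's.
  isKAdjGen-join⇒isKAdjGen : ∀ {k} b S → IsKAdjGen (join H) k (b ∷ S) → IsKAdjGen H k S
  isKAdjGen-join⇒isKAdjGen false S gen x y x≢y = gen (suc x) (suc y) (x≢y ∘ F.suc-injective)
  isKAdjGen-join⇒isKAdjGen true  S gen x y x≢y = gen (suc x) (suc y) (x≢y ∘ F.suc-injective)

  apex-separated : DiameterAtLeast H 6 → ∀ {k} S → IsKAdjGen H k S →
                   ∀ y → k ≤ ∣ (outside ∷ S) ∩ 𝒞 (join H) zero (suc y) ∣
  apex-separated diam S gen y with farPair diam y
  ... | a , b , a≢b , y≁a , y≁b = ≤-trans (gen a b a≢b) (∣∩∣-monoʳ S 𝒞⊆)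
    where
    𝒞⊆ : 𝒞 H a b ⊆ tail (𝒞 (join H) zero (suc y))
    𝒞⊆ z∈ = drop-there {s = inside} (∈𝒞-join-apex y (farPair-separator {G = H} y≁a y≁b z∈))

  isKAdjGen⇒isKAdjGen-join : DiameterAtLeast H 6 → ∀ {k} S → IsKAdjGen H k S →
                             IsKAdjGen (join H) k (outside ∷ S)
  isKAdjGen⇒isKAdjGen-join diam S gen zero    zero    0≢0 = ⊥-elim (0≢0 refl)
  isKAdjGen⇒isKAdjGen-join diam S gen (suc x) (suc y) x≢y = gen x y λ e → x≢y (cong suc e)
  isKAdjGen⇒isKAdjGen-join diam S gen zero    (suc y) _   = apex-separated diam S gen y
  isKAdjGen⇒isKAdjGen-join diam S gen (suc y) zero _ =
    ≤-trans (apex-separated diam S gen y) (∣∩∣-monoʳ (outside ∷ S) (𝒞-comm (join H) zero (suc y)))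

isKAdjGen? : ∀ {n} (G : Graph n) k → Decidable (IsKAdjGen G k)
isKAdjGen? G k S = F.all? λ x → F.all? λ y → ¬? (x F.≟ y) →-dec (k ≤? ∣ S ∩ 𝒞 G x y ∣)

minimumSubset : ∀ {n} {P : Subset n → Set} → Decidable P → ∀ S → P S →
                Σ (Subset n) λ M → P M × (∀ T → P T → ∣ M ∣ ≤ ∣ T ∣)
minimumSubset {P = P} P? S pS = descend S pS (<-wellFounded ∣ S ∣)
  where
  descend : ∀ S → P S → Acc _<_ ∣ S ∣ → Σ _ λ M → P M × (∀ T → P T → ∣ M ∣ ≤ ∣ T ∣)
  descend S pS (acc smaller) with anySubset? (λ T → P? T ×-dec (∣ T ∣ <? ∣ S ∣))
  ... | yes (T , pT , T<S) = descend T pT (smaller T<S)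
  ... | no ∄T = S , pS , λ T pT → ≮⇒≥ λ T<S → ∄T (T , pT , T<S)

isAdim-exists : ∀ {n} (G : Graph n) k S → IsKAdjGen G k S → Σ ℕ (IsAdim G k)
isAdim-exists G k S gen with minimumSubset (isKAdjGen? G k) S gen
... | M , M-gen , M-min = ∣ M ∣ , (M , M-gen , refl) , M-min

≤𝒞⇒⊤-isKAdjGen : ∀ {n} (G : Graph n) {k} → k ≤𝒞 G → IsKAdjGen G k ⊤
≤𝒞⇒⊤-isKAdjGen G k≤𝒞 x y x≢y =
  subst (_ ≤_) (cong ∣_∣ (≡-sym (∩-identityˡ (𝒞 G x y)))) (k≤𝒞 x y x≢y)

≤𝒞-join⇒≤𝒞 : ∀ {n} (H : Graph n) {k} → k ≤𝒞 join H → k ≤𝒞 H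
≤𝒞-join⇒≤𝒞 H k≤𝒞 x y x≢y = k≤𝒞 (suc x) (suc y) λ e → x≢y (F.suc-injective e)

isAdim-join : ∀ {n} {H : Graph n} {k m} → DiameterAtLeast H 6 → IsAdim H k m → IsAdim (join H) k m
isAdim-join diam ((S , gen , ∣S∣≡m) , minimal) =
  (outside ∷ S , isKAdjGen⇒isKAdjGen-join diam S gen , ∣S∣≡m) ,
  λ { (b ∷ T) gen′ → ≤-trans (minimal T (isKAdjGen-join⇒isKAdjGen b T gen′)) (∣p∣≤∣x∷p∣ b T) }

corollary27 : ∀ {n} (H : Graph n) → DiameterAtLeast H 6 → (k : ℕ) → 1 ≤ k → k ≤𝒞 join H →
                Σ ℕ λ m → IsAdim (join H) k m × IsAdim H k m
corollary27 H diam k _ k≤𝒞 with isAdim-exists H k ⊤ (≤𝒞⇒⊤-isKAdjGen H (≤𝒞-join⇒≤𝒞 H k≤𝒞))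
... | m , adim = m , isAdim-join diam adim , adim
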